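{- Let $S,T,R$ be semigroups and $\varphi:S\to T$, $\psi:S\to R$ semigroup homomorphisms. Let $L_R=\{\ell_r: r\in R\}$ be the left-zero band on $R$ (so $\ell_r\ell_{r'}=\ell_r$), and equip $T\times L_R$ with the componentwise product $(t,\ell_r)(t',\ell_{r'})=(tt',\ell_r)$. Then the disjoint union $S\cup(T\times L_R)$ is a semigroup under the operation that agrees with the given products on $S$ and on $T\times L_R$ and satisfies $s(t,\ell_r)=(\varphi(s)t,\ell_{\psi(s)r})$ and $(t,\ell_r)s=(t\varphi(s),\ell_r)$ for all $s\in S$, $t\in T$, $r\in R$.
   Context: A left-zero band on an index set $I$ is the semigroup $\{\ell_i: i\in I\}$ with $\ell_i\ell_j=\ell_i$ for all $i,j$. -}

module Defs where

open import Level using (Level; _⊔_)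
open import Algebra.Bundles using (Semigroup)
open import Data.Sum using (_⊎_; inj₁; inj₂)
open import Data.Product using (_×_; _,_)
open import Data.Sum.Relation.Binary.Pointwise using (Pointwise)
open import Data.Product.Relation.Binary.Pointwise.NonDependent
  using () renaming (Pointwise to ×-Pointwise)

module _ {a} (I : Set a) where
  LeftZeroBand : Set a
  LeftZeroBand = I

  lzMul : LeftZeroBand → LeftZeroBand → LeftZeroBand
  lzMul i j = i

module _ {c₁ ℓ₁ c₂ ℓ₂ c₃ ℓ₃}
         (S : Semigroup c₁ ℓ₁) (T : Semigroup c₂ ℓ₂) (R : Semigroup c₃ ℓ₃)
         (φ : Semigroup.Carrier S → Semigroup.Carrier T)
         (ψ : Semigroup.Carrier S → Semigroup.Carrier R) where

  private
    module S = Semigroup S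
    module T = Semigroup T
    module R = Semigroup R

  Glued : Set (c₁ ⊔ c₂ ⊔ c₃)
  Glued = S.Carrier ⊎ (T.Carrier × LeftZeroBand R.Carrier)

  _≈G_ : Glued → Glued → Set (c₁ ⊔ c₂ ⊔ c₃ ⊔ ℓ₁ ⊔ ℓ₂ ⊔ ℓ₃)
  _≈G_ = Pointwise S._≈_ (×-Pointwise T._≈_ R._≈_)

  _·G_ : Glued → Glued → Glued
  inj₁ s        ·G inj₁ s'        = inj₁ (s S.∙ s')
  inj₁ s        ·G inj₂ (t , r)   = inj₂ (φ s T.∙ t , ψ s R.∙ r)
  inj₂ (t , r)  ·G inj₁ s         = inj₂ (t T.∙ φ s , r)
  inj₂ (t , r)  ·G inj₂ (t' , r') = inj₂ (t T.∙ t' , lzMul R.Carrier r r')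

{-# OPTIONS --safe #-}
module Submission where

open import Defs
open import Algebra.Bundles using (Semigroup)
open import Algebra.Structures using (IsSemigroup)
open import Algebra.Morphism.Structures using (IsMagmaHomomorphism)
open import Data.Sum.Relation.Binary.Pointwise using (inj₁; inj₂; ⊎-isEquivalence)
open import Data.Sum using (inj₁; inj₂)
open import Data.Product using (_,_)
open import Data.Product.Relation.Binary.Pointwise.NonDependent using (×-isEquivalence)
open import Relation.Binary.Structures using (IsEquivalence)
import Relation.Binary.Reasoning.Setoid as SetoidReasoning

module _ {c₁ ℓ₁ c₂ ℓ₂} (S : Semigroup c₁ ℓ₁) (T : Semigroup c₂ ℓ₂)
         {f : Semigroup.Carrier S → Semigroup.Carrier T}
         (homo : IsMagmaHomomorphism (Semigroup.rawMagma S) (Semigroup.rawMagma T) f) where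

  private
    module S = Semigroup S
    module T = Semigroup T
    module H = IsMagmaHomomorphism homo
  open SetoidReasoning T.setoid

  homo-actˡ-assoc : ∀ s s' t → f (s S.∙ s') T.∙ t T.≈ f s T.∙ (f s' T.∙ t)
  homo-actˡ-assoc s s' t = begin
    f (s S.∙ s') T.∙ t    ≈⟨ T.∙-congʳ (H.homo s s') ⟩
    (f s T.∙ f s') T.∙ t  ≈⟨ T.assoc (f s) (f s') t ⟩
    f s T.∙ (f s' T.∙ t)  ∎

  homo-actʳ-assoc : ∀ t s s' → (t T.∙ f s) T.∙ f s' T.≈ t T.∙ f (s S.∙ s')
  homo-actʳ-assoc t s s' = begin
    (t T.∙ f s) T.∙ f s'  ≈⟨ T.assoc t (f s) (f s') ⟩
    t T.∙ (f s T.∙ f s')  ≈⟨ T.∙-congˡ (H.homo s s') ⟨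
    t T.∙ f (s S.∙ s')    ∎

module _ {c₁ ℓ₁ c₂ ℓ₂ c₃ ℓ₃}
         (S : Semigroup c₁ ℓ₁) (T : Semigroup c₂ ℓ₂) (R : Semigroup c₃ ℓ₃)
         (φ : Semigroup.Carrier S → Semigroup.Carrier T)
         (ψ : Semigroup.Carrier S → Semigroup.Carrier R) where

  private
    module S = Semigroup S
    module T = Semigroup T
    module R = Semigroup R
    _≈_ = _≈G_ S T R φ ψ
    _·_ = _·G_ S T R φ ψ

  ≈G-isEquivalence : IsEquivalence _≈_
  ≈G-isEquivalence =
    ⊎-isEquivalence S.isEquivalence (×-isEquivalence T.isEquivalence R.isEquivalence)

  module _ (hφ : IsMagmaHomomorphism S.rawMagma T.rawMagma φ)
           (hψ : IsMagmaHomomorphism S.rawMagma R.rawMagma ψ) where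

    private
      module Hφ = IsMagmaHomomorphism hφ
      module Hψ = IsMagmaHomomorphism hψ

    ·G-cong : ∀ {x y u v} → x ≈ y → u ≈ v → (x · u) ≈ (y · v)
    ·G-cong (inj₁ s≈)       (inj₁ s'≈)        = inj₁ (S.∙-cong s≈ s'≈)
    ·G-cong (inj₁ s≈)       (inj₂ (t≈ , r≈))  =
      inj₂ (T.∙-cong (Hφ.⟦⟧-cong s≈) t≈ , R.∙-cong (Hψ.⟦⟧-cong s≈) r≈)
    ·G-cong (inj₂ (t≈ , r≈)) (inj₁ s≈)        = inj₂ (T.∙-cong t≈ (Hφ.⟦⟧-cong s≈) , r≈)
    ·G-cong (inj₂ (t≈ , r≈)) (inj₂ (t'≈ , _)) = inj₂ (T.∙-cong t≈ t'≈ , r≈)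

    -- The L_R component of a product is decided by its leftmost factor from T × L_R (twisted by
    -- ψ of the S-factors before it), so ψ's homomorphism property is needed only for s s' (t , r).
    ·G-assoc : ∀ x y z → ((x · y) · z) ≈ (x · (y · z))
    ·G-assoc (inj₁ s)       (inj₁ s')        (inj₁ s'')       = inj₁ (S.assoc s s' s'')
    ·G-assoc (inj₁ s)       (inj₁ s')        (inj₂ (t , r))   =
      inj₂ (homo-actˡ-assoc S T hφ s s' t , homo-actˡ-assoc S R hψ s s' r)
    ·G-assoc (inj₁ s)       (inj₂ (t , _))   (inj₁ s')        = inj₂ (T.assoc (φ s) t (φ s') , R.refl)
    ·G-assoc (inj₁ s)       (inj₂ (t , _))   (inj₂ (t' , _))  = inj₂ (T.assoc (φ s) t t' , R.refl)
    ·G-assoc (inj₂ (t , _)) (inj₁ s)         (inj₁ s')        = inj₂ (homo-actʳ-assoc S T hφ t s s' , R.refl)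
    ·G-assoc (inj₂ (t , _)) (inj₁ s)         (inj₂ (t' , _))  = inj₂ (T.assoc t (φ s) t' , R.refl)
    ·G-assoc (inj₂ (t , _)) (inj₂ (t' , _))  (inj₁ s)         = inj₂ (T.assoc t t' (φ s) , R.refl)
    ·G-assoc (inj₂ (t , _)) (inj₂ (t' , _))  (inj₂ (t'' , _)) = inj₂ (T.assoc t t' t'' , R.refl)

lemma3p10 : ∀ {c₁ ℓ₁ c₂ ℓ₂ c₃ ℓ₃}
    (S : Semigroup c₁ ℓ₁) (T : Semigroup c₂ ℓ₂) (R : Semigroup c₃ ℓ₃)
    (φ : Semigroup.Carrier S → Semigroup.Carrier T)
    (ψ : Semigroup.Carrier S → Semigroup.Carrier R) →
    IsMagmaHomomorphism (Semigroup.rawMagma S) (Semigroup.rawMagma T) φ →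
    IsMagmaHomomorphism (Semigroup.rawMagma S) (Semigroup.rawMagma R) ψ →
    IsSemigroup (_≈G_ S T R φ ψ) (_·G_ S T R φ ψ)
lemma3p10 S T R φ ψ hφ hψ = record
  { isMagma = record
    { isEquivalence = ≈G-isEquivalence S T R φ ψ
    ; ∙-cong        = ·G-cong S T R φ ψ hφ hψ
    }
  ; assoc = ·G-assoc S T R φ ψ hφ hψ
  }
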